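{- Let $\mathcal{S}=\langle\mathbf{Fm},\vdash\rangle$ be a finitary Hilbert-style logic over a language containing a binary connective $\longrightarrow$, such that modus ponens $\frac{\alpha,\ \alpha\longrightarrow\beta}{\beta}$ is one of its rules of inference, and such that the Deduction theorem holds in $\mathcal{S}$ (for all $\Sigma\cup\{\alpha,\beta\}\subseteq\mathit{Fm}$, $\Sigma\cup\{\alpha\}\vdash\beta$ implies $\Sigma\vdash\alpha\longrightarrow\beta$). Then the restricted rules companion of $\mathcal{S}$ coincides with the left variable inclusion companion of $\mathcal{S}$, i.e. $\vdash^{re}=\vdash^l$.
   Context: $\mathbf{Fm}$ is the formula algebra of a logical language (connectives of finite arity) over a countably infinite set $V$ of variables, universe $\mathit{Fm}$. A Hilbert-style logic is given by schematic (substitution-closed) sets of axioms $A$ and rules $R$ (written $\frac{\Gamma}{\alpha}$); $\Sigma\vdash\varphi$ iff there is a finite sequence ending in $\varphi$ each member of which is an axiom, a member of $\Sigma$, or obtained from earlier members by a rule. Finitary: whenever $\Sigma\vdash\varphi$ there is finite $\Sigma'\subseteq\Sigma$ with $\Sigma'\vdash\varphi$. $\mathrm{var}(\varphi)$ is the set of variables of $\varphi$, $\mathrm{var}(\Gamma)=\bigcup_{\gamma\in\Gamma}\mathrm{var}(\gamma)$. Left variable inclusion companion: $\Gamma\vdash^l\varphi$ iff there is $\Gamma'\subseteq\Gamma$ with $\mathrm{var}(\Gamma')\subseteq\mathrm{var}(\varphi)$ and $\Gamma'\vdash\varphi$. Restricted rules companion $\vdash^{re}$: the Hilbert-style consequence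 with the same axioms $A$ and rules $\{\frac{\Gamma}{\alpha}\in R\mid\mathrm{var}(\Gamma)\subseteq\mathrm{var}(\alpha)\}$. -}

module Defs where

open import Data.Nat using (ℕ)
open import Data.Vec using (Vec; []; _∷_)
open import Data.Vec.Relation.Unary.Any using (Any)
open import Data.List using (List)
open import Data.List.Membership.Propositional using (_∈_)
open import Data.Product using (Σ; ∃; _×_; _,_)
open import Data.Sum using (_⊎_)
open import Relation.Binary.PropositionalEquality using (_≡_; subst)
open import Function.Bundles using (_⇔_)

record Signature : Set₁ where
  field
    Op    : Set
    arity : Op → ℕ

module Lang (L : Signature) where
  open Signature L

  data Fm : Set where
    var : ℕ → Fm
    app : (o : Op) → Vec Fm (arity o) → Fm

  mutual
    sub : (ℕ → Fm) → Fm → Fm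
    sub σ (var x)    = σ x
    sub σ (app o as) = app o (subs σ as)

    subs : ∀ {n} → (ℕ → Fm) → Vec Fm n → Vec Fm n
    subs σ []       = []
    subs σ (a ∷ as) = sub σ a ∷ subs σ as

  data _occursIn_ (x : ℕ) : Fm → Set where
    here  : x occursIn var x
    there : ∀ {o as} → Any (x occursIn_) as → x occursIn app o as

  FmSet : Set₁
  FmSet = Fm → Set

  _⊆_ : FmSet → FmSet → Set
  Γ ⊆ Δ = ∀ {γ} → Γ γ → Δ γ

  VarsIncl : FmSet → Fm → Set
  VarsIncl Γ φ = ∀ {γ} → Γ γ → ∀ x → x occursIn γ → x occursIn φ

  image : (ℕ → Fm) → FmSet → FmSet
  image σ Γ γ = ∃ λ δ → Γ δ × γ ≡ sub σ δ

  _∪｛_｝ : FmSet → Fm → FmSet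
  (Γ ∪｛ α ｝) γ = Γ γ ⊎ γ ≡ α

  record Hilbert : Set₁ where
    field
      Ax    : FmSet
      Rule  : Set
      prem  : Rule → FmSet
      concl : Rule → Fm

  Schematic : Hilbert → Set
  Schematic H =
    (∀ σ φ → Ax φ → Ax (sub σ φ)) ×
    (∀ σ r → Σ Rule λ r' → concl r' ≡ sub σ (concl r)
                          × (∀ γ → prem r' γ ⇔ image σ (prem r) γ))
    where open Hilbert H

  module Deriv (H : Hilbert) where
    open Hilbert H

    data Justified (Γ : FmSet) (ps : List Fm) (φ : Fm) : Set where
      axiom : Ax φ → Justified Γ ps φ
      hyp   : Γ φ → Justified Γ ps φ
      rule  : (r : Rule) → concl r ≡ φ
            → (∀ {γ} → prem r γ → γ ∈ ps) → Justified Γ ps φ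

    -- Valid finite derivation sequences, stored in reverse order
    -- (head = last member).
    data DerSeq (Γ : FmSet) : List Fm → Set where
      []  : DerSeq Γ Data.List.[]
      _∷_ : ∀ {φ ps} → Justified Γ ps φ → DerSeq Γ ps → DerSeq Γ (φ Data.List.∷ ps)

    _⊢_ : FmSet → Fm → Set
    Γ ⊢ φ = ∃ λ ps → DerSeq Γ (φ Data.List.∷ ps)

  Finitary : Hilbert → Set₁
  Finitary H = ∀ Γ φ → Γ ⊢ φ →
    ∃ λ (Δ : List Fm) → (∀ {γ} → γ ∈ Δ → Γ γ) × ((λ γ → γ ∈ Δ) ⊢ φ)
    where open Deriv H

  _⊢ˡ[_]_ : FmSet → Hilbert → Fm → Set₁
  Γ ⊢ˡ[ H ] φ = Σ FmSet λ Γ' → Γ' ⊆ Γ × VarsIncl Γ' φ × Deriv._⊢_ H Γ' φ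

  restrict : Hilbert → Hilbert
  restrict H = record
    { Ax    = Ax
    ; Rule  = Σ Rule (λ r → VarsIncl (prem r) (concl r))
    ; prem  = λ r → prem (Data.Product.proj₁ r)
    ; concl = λ r → concl (Data.Product.proj₁ r)
    }
    where open Hilbert H

  _⊢ʳᵉ[_]_ : FmSet → Hilbert → Fm → Set
  Γ ⊢ʳᵉ[ H ] φ = Deriv._⊢_ (restrict H) Γ φ

  binApp : (o : Op) → arity o ≡ 2 → Fm → Fm → Fm
  binApp o eq α β = app o (subst (Vec Fm) (Relation.Binary.PropositionalEquality.sym eq) (α ∷ β ∷ []))

  HasMP : (H : Hilbert) (o : Signature.Op L) → arity o ≡ 2 → Set
  HasMP H o eq = ∀ α β → Σ Rule λ r → concl r ≡ β
                   × (∀ γ → prem r γ ⇔ (γ ≡ α ⊎ γ ≡ binApp o eq α β))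
    where open Hilbert H

  DeductionThm : (H : Hilbert) (o : Signature.Op L) → arity o ≡ 2 → Set₁
  DeductionThm H o eq = ∀ (Γ : FmSet) α β → (Γ ∪｛ α ｝) ⊢ β → Γ ⊢ binApp o eq α β
    where open Deriv H

-- A restricted derivation becomes a left-variable-inclusion derivation by deleting every member
-- whose variables are not among those of the conclusion: a restricted rule never draws on a member
-- with more variables than its conclusion. Conversely, by finitarity a derivation Γ' ⊢ φ with
-- var(Γ') ⊆ var(φ) may be taken from a finite list δ₁ … δₙ, and the Deduction theorem peels the
-- hypotheses off one at a time: δ₁ … δₙ₋₁ ⊢ δₙ ⟶ φ, whose variables still include those of the
-- remaining hypotheses, followed by modus ponens on δₙ and δₙ ⟶ φ, a restricted instance since
-- var(δₙ) ⊆ var(φ). What is left is a theorem ⊢ ψ; in its derivation every rule application with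
-- conclusion χ is replaced by the instance sending the variables outside χ to χ itself, which is
-- restricted, and since theorems are closed under substitution this works for all instances at once.
module Submission where

open import Defs
open import Data.Nat using (ℕ)
open import Relation.Binary.PropositionalEquality using (_≡_)
open import Data.Product using (_×_)

open import Data.Nat using (_≟_)
open import Relation.Binary.PropositionalEquality using (refl; sym; trans; cong; cong₂; subst)
open import Data.Product using (Σ; ∃; _,_; proj₁; proj₂)
open import Data.Sum using (_⊎_; inj₁; inj₂; [_,_]′)
open import Data.Empty using (⊥-elim)
open import Function using (_∘_; id)
open import Function.Bundles using (Equivalence)
open import Relation.Nullary using (Dec; yes; no; ¬_)
open import Relation.Nullary.Decidable using (map′; _⊎-dec_; _×-dec_)
open import Data.Vec using (Vec; []; _∷_)
open import Data.Vec.Relation.Unary.Any using (Any; here; there; toSum; fromSum)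
open import Data.List using (List; map; filter; _++_)
import Data.List.Relation.Unary.Any as ListAny
open import Data.List.Relation.Unary.All using (All) renaming (map to All-map)
open import Data.List.Relation.Unary.All.Properties using (map⁺)
open import Data.List.Membership.Propositional using (_∈_)
open import Data.List.Membership.Propositional.Properties using (∈-map⁺; ∈-++⁺ˡ; ∈-++⁺ʳ; ∈-filter⁺)

module _ (L : Signature) where
  open Signature L
  open Lang L

  _⊆ᵛ_ : Fm → Fm → Set
  ψ ⊆ᵛ φ = ∀ x → x occursIn ψ → x occursIn φ

  ⊆ᵛ-refl : ∀ {φ} → φ ⊆ᵛ φ
  ⊆ᵛ-refl x p = p

  mutual
    _occursIn?_ : ∀ x φ → Dec (x occursIn φ)
    x occursIn? var y    = map′ (λ { refl → Lang.here }) (λ { Lang.here → refl }) (x ≟ y)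
    x occursIn? app o as = map′ Lang.there (λ { (Lang.there p) → p }) (x occursInAny? as)

    _occursInAny?_ : ∀ {n} x (as : Vec Fm n) → Dec (Any (x occursIn_) as)
    x occursInAny? []       = no λ ()
    x occursInAny? (a ∷ as) = map′ fromSum toSum (x occursIn? a ⊎-dec x occursInAny? as)

  mutual
    _⊆ᵛ?_ : ∀ ψ φ → Dec (ψ ⊆ᵛ φ)
    var y ⊆ᵛ? φ    = map′ (λ { p _ Lang.here → p }) (λ s → s y Lang.here) (y occursIn? φ)
    app o as ⊆ᵛ? φ = map′ (λ { s x (Lang.there p) → s x p }) (λ s x → s x ∘ Lang.there) (as ⊆ᵛAll? φ)

    _⊆ᵛAll?_ : ∀ {n} (as : Vec Fm n) φ → Dec (∀ x → Any (x occursIn_) as → x occursIn φ)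
    [] ⊆ᵛAll? φ       = yes λ _ ()
    (a ∷ as) ⊆ᵛAll? φ =
      map′ (λ (s , t) x → [ s x , t x ]′ ∘ toSum) (λ s → (λ x → s x ∘ here) , (λ x → s x ∘ there))
           (a ⊆ᵛ? φ ×-dec as ⊆ᵛAll? φ)

  mutual
    occursIn-sub⁺ : ∀ {x y} σ ψ → y occursIn ψ → x occursIn σ y → x occursIn sub σ ψ
    occursIn-sub⁺ σ (var _)    Lang.here      q = q
    occursIn-sub⁺ σ (app o as) (Lang.there p) q = Lang.there (occursInAny-subs⁺ σ as p q)

    occursInAny-subs⁺ : ∀ {n x y} σ (as : Vec Fm n) →
      Any (y occursIn_) as → x occursIn σ y → Any (x occursIn_) (subs σ as)
    occursInAny-subs⁺ σ (a ∷ as) (here p)  q = here (occursIn-sub⁺ σ a p q)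
    occursInAny-subs⁺ σ (a ∷ as) (there p) q = there (occursInAny-subs⁺ σ as p q)

  mutual
    occursIn-sub⁻ : ∀ {x} σ ψ → x occursIn sub σ ψ → ∃ λ y → y occursIn ψ × x occursIn σ y
    occursIn-sub⁻ σ (var y)    p              = y , Lang.here , p
    occursIn-sub⁻ σ (app o as) (Lang.there p) with occursInAny-subs⁻ σ as p
    ... | y , q , r = y , Lang.there q , r

    occursInAny-subs⁻ : ∀ {n x} σ (as : Vec Fm n) →
      Any (x occursIn_) (subs σ as) → ∃ λ y → Any (y occursIn_) as × x occursIn σ y
    occursInAny-subs⁻ σ (a ∷ as) (here p) with occursIn-sub⁻ σ a p
    ... | y , q , r = y , here q , r
    occursInAny-subs⁻ σ (a ∷ as) (there p) with occursInAny-subs⁻ σ as p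
    ... | y , q , r = y , there q , r

  sub-⊆ᵛ : ∀ {χ} σ ψ → (∀ y → σ y ⊆ᵛ χ) → sub σ ψ ⊆ᵛ χ
  sub-⊆ᵛ σ ψ s x p with occursIn-sub⁻ σ ψ p
  ... | y , _ , q = s y x q

  mutual
    sub-cong : ∀ σ τ ψ → (∀ x → x occursIn ψ → σ x ≡ τ x) → sub σ ψ ≡ sub τ ψ
    sub-cong σ τ (var x)    e = e x Lang.here
    sub-cong σ τ (app o as) e = cong (app o) (subs-cong σ τ as (λ x → e x ∘ Lang.there))

    subs-cong : ∀ {n} σ τ (as : Vec Fm n) →
      (∀ x → Any (x occursIn_) as → σ x ≡ τ x) → subs σ as ≡ subs τ as
    subs-cong σ τ []       e = refl
    subs-cong σ τ (a ∷ as) e = cong₂ _∷_ (sub-cong σ τ a (λ x → e x ∘ here)) (subs-cong σ τ as (λ x → e x ∘ there))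

  mutual
    sub-var : ∀ ψ → sub var ψ ≡ ψ
    sub-var (var x)    = refl
    sub-var (app o as) = cong (app o) (subs-var as)

    subs-var : ∀ {n} (as : Vec Fm n) → subs var as ≡ as
    subs-var []       = refl
    subs-var (a ∷ as) = cong₂ _∷_ (sub-var a) (subs-var as)

  -- Instantiating a rule with conclusion φ by pad τ φ yields a restricted rule with conclusion τφ
  -- (pad-⊆ᵛ, sub-pad).
  pad : (ℕ → Fm) → Fm → ℕ → Fm
  pad τ φ y with y occursIn? φ
  ... | yes _ = τ y
  ... | no _  = sub τ φ

  pad-agrees : ∀ τ φ y → y occursIn φ → pad τ φ y ≡ τ y
  pad-agrees τ φ y p with y occursIn? φ
  ... | yes _ = refl
  ... | no ¬p = ⊥-elim (¬p p)

  pad-⊆ᵛ : ∀ τ φ y → pad τ φ y ⊆ᵛ sub τ φ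
  pad-⊆ᵛ τ φ y with y occursIn? φ
  ... | yes p = λ x → occursIn-sub⁺ τ φ p
  ... | no _  = ⊆ᵛ-refl

  sub-pad : ∀ τ φ → sub (pad τ φ) φ ≡ sub τ φ
  sub-pad τ φ = sub-cong (pad τ φ) τ φ (pad-agrees τ φ)

  module _ (o : Op) (ar : arity o ≡ 2) where

    binApp-⊆ᵛ : ∀ {α β χ} → α ⊆ᵛ χ → β ⊆ᵛ χ → binApp o ar α β ⊆ᵛ χ
    binApp-⊆ᵛ α⊆χ β⊆χ x (Lang.there p) = [ α⊆χ x , β⊆χ x ]′ (toSum₂ ar p)
      where
      toSum₂ : ∀ {n} {P : Fm → Set} {a b} (e : n ≡ 2) → Any P (subst (Vec Fm) (sym e) (a ∷ b ∷ [])) → P a ⊎ P b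
      toSum₂ refl (here p)         = inj₁ p
      toSum₂ refl (there (here p)) = inj₂ p

    ⊆ᵛ-binAppʳ : ∀ α β → β ⊆ᵛ binApp o ar α β
    ⊆ᵛ-binAppʳ α β x p = Lang.there (fromʳ ar p)
      where
      fromʳ : ∀ {n} {P : Fm → Set} {a b} (e : n ≡ 2) → P b → Any P (subst (Vec Fm) (sym e) (a ∷ b ∷ []))
      fromʳ refl p = there (here p)

  module _ {H : Hilbert} where
    open Hilbert H
    open Deriv H

    Justified-mono : ∀ {Γ Δ ps qs φ} → Γ ⊆ Δ → (∀ {γ} → γ ∈ ps → γ ∈ qs) → Justified Γ ps φ → Justified Δ qs φ
    Justified-mono s m (axiom a)    = axiom a
    Justified-mono s m (hyp h)      = hyp (s h)
    Justified-mono s m (rule r e p) = rule r e (m ∘ p)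

    DerSeq-mono : ∀ {Γ Δ ps} → Γ ⊆ Δ → DerSeq Γ ps → DerSeq Δ ps
    DerSeq-mono s []      = []
    DerSeq-mono s (j ∷ d) = Justified-mono s id j ∷ DerSeq-mono s d

    ⊢-mono : ∀ {Γ Δ φ} → Γ ⊆ Δ → Γ ⊢ φ → Δ ⊢ φ
    ⊢-mono s (ps , d) = ps , DerSeq-mono s d

    _++ᵈ_ : ∀ {Γ ps qs} → DerSeq Γ ps → DerSeq Γ qs → DerSeq Γ (ps ++ qs)
    [] ++ᵈ e = e
    _++ᵈ_ {qs = qs} (j ∷ d) e = Justified-mono id (∈-++⁺ˡ {ys = qs}) j ∷ (d ++ᵈ e)

    derive-all : ∀ {Γ} (φs : List Fm) → All (Γ ⊢_) φs → ∃ λ qs → DerSeq Γ qs × (∀ {φ} → φ ∈ φs → φ ∈ qs)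
    derive-all List.[] All.[] = List.[] , [] , λ ()
    derive-all (φ List.∷ φs) ((ps , d) All.∷ ds) with derive-all φs ds
    ... | qs , e , mem =
      (φ List.∷ ps) ++ qs , d ++ᵈ e ,
      λ { (ListAny.here refl) → ListAny.here refl ; (ListAny.there p) → ∈-++⁺ʳ (φ List.∷ ps) (mem p) }

  _↾_ : FmSet → Fm → FmSet
  (Γ ↾ φ) γ = Γ γ × γ ⊆ᵛ φ

  module _ (H : Hilbert) where
    open Hilbert H
    private
      module D = Deriv H
      module R = Deriv (restrict H)

    Justified-filter : ∀ {Γ ps ψ} φ → ψ ⊆ᵛ φ → R.Justified Γ ps ψ → D.Justified (Γ ↾ φ) (filter (_⊆ᵛ? φ) ps) ψ
    Justified-filter φ s (R.axiom a)              = D.axiom a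
    Justified-filter φ s (R.hyp h)                = D.hyp (h , s)
    Justified-filter φ s (R.rule (r , vi) refl m) =
      D.rule r refl (λ p → ∈-filter⁺ (_⊆ᵛ? φ) (m p) (λ x → s x ∘ vi p x))

    DerSeq-filter : ∀ {Γ ps} φ → R.DerSeq Γ ps → D.DerSeq (Γ ↾ φ) (filter (_⊆ᵛ? φ) ps)
    DerSeq-filter φ R.[] = D.[]
    DerSeq-filter φ (R._∷_ {ψ} j d) with ψ ⊆ᵛ? φ
    ... | yes s = Justified-filter φ s j D.∷ DerSeq-filter φ d
    ... | no _  = DerSeq-filter φ d

    restricted⇒left : ∀ {Γ φ} → Γ ⊢ʳᵉ[ H ] φ → Γ ⊢ˡ[ H ] φ
    restricted⇒left {Γ} {φ} (ps , j R.∷ d) =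
      Γ ↾ φ , proj₁ , proj₂ , filter (_⊆ᵛ? φ) ps , Justified-filter φ ⊆ᵛ-refl j D.∷ DerSeq-filter φ d

  module _ (H : Hilbert) (sch : Schematic H) where
    open Hilbert H
    private
      module D = Deriv H
      module R = Deriv (restrict H)

    restricted-instance : ∀ r τ → Σ (Hilbert.Rule (restrict H)) λ r' →
      concl (proj₁ r') ≡ sub τ (concl r) × (∀ {γ} → prem (proj₁ r') γ → image (pad τ (concl r)) (prem r) γ)
    restricted-instance r τ = (r' , vars-incl) , concl-eq , Equivalence.to (prem-eq _)
      where
      φ = concl r
      instance-of-r = proj₂ sch (pad τ φ) r
      r'       = proj₁ instance-of-r
      prem-eq  = proj₂ (proj₂ instance-of-r)
      concl-eq : concl r' ≡ sub τ φ
      concl-eq = trans (proj₁ (proj₂ instance-of-r)) (sub-pad τ φ)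
      vars-incl : VarsIncl (prem r') (concl r')
      vars-incl p with Equivalence.to (prem-eq _) p
      ... | δ , _ , refl = subst (sub (pad τ φ) δ ⊆ᵛ_) (sym concl-eq) (sub-⊆ᵛ (pad τ φ) δ (pad-⊆ᵛ τ φ))

    RestrictedInstances : FmSet → Fm → Set
    RestrictedInstances Γ ψ = ∀ τ → Γ ⊢ʳᵉ[ H ] sub τ ψ

    Justified-instances : ∀ {Γ₀ Γ ps φ} → (∀ {γ} → ¬ Γ₀ γ) →
      All (RestrictedInstances Γ) ps → D.Justified Γ₀ ps φ → RestrictedInstances Γ φ
    Justified-instances {φ = φ} ¬Γ₀ ih (D.axiom a) τ = List.[] , R.axiom (proj₁ sch τ φ a) R.∷ R.[]
    Justified-instances ¬Γ₀ ih (D.hyp h) τ = ⊥-elim (¬Γ₀ h)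
    Justified-instances {Γ = Γ} {ps} ¬Γ₀ ih (D.rule r refl m) τ
      with restricted-instance r τ
         | derive-all (map (sub (pad τ (concl r))) ps) (map⁺ (All-map (λ f → f (pad τ (concl r))) ih))
    ... | r' , concl-eq , prem-inst | qs , d , mem = qs , R.rule r' concl-eq premises-derived R.∷ d
      where
      premises-derived : ∀ {γ} → prem (proj₁ r') γ → γ ∈ qs
      premises-derived p with prem-inst p
      ... | δ , δ∈prem , refl = mem (∈-map⁺ _ (m δ∈prem))

    closed⇒restricted-instances : ∀ {Γ₀ Γ ps} → (∀ {γ} → ¬ Γ₀ γ) → D.DerSeq Γ₀ ps → All (RestrictedInstances Γ) ps
    closed⇒restricted-instances ¬Γ₀ D.[]      = All.[]
    closed⇒restricted-instances ¬Γ₀ (j D.∷ d) =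
      Justified-instances ¬Γ₀ ih j All.∷ ih
      where ih = closed⇒restricted-instances ¬Γ₀ d

    closed⇒restricted : ∀ {Γ₀ Γ φ} → (∀ {γ} → ¬ Γ₀ γ) → Γ₀ D.⊢ φ → Γ ⊢ʳᵉ[ H ] φ
    closed⇒restricted {Γ = Γ} ¬Γ₀ (ps , d) with closed⇒restricted-instances ¬Γ₀ d
    ... | instances All.∷ _ = subst (Γ ⊢ʳᵉ[ H ]_) (sub-var _) (instances var)

    module _ (imp : Op) (ar : arity imp ≡ 2) where
      private
        _⟶_ : Fm → Fm → Fm
        _⟶_ = binApp imp ar

      restricted-mp : HasMP H imp ar → ∀ {Γ δ ψ} → δ ⊆ᵛ ψ →
        Γ ⊢ʳᵉ[ H ] δ → Γ ⊢ʳᵉ[ H ] (δ ⟶ ψ) → Γ ⊢ʳᵉ[ H ] ψ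
      restricted-mp mp {δ = δ} {ψ} δ⊆ψ (ps , dδ) (qs , d⟶) =
        (δ List.∷ ps) ++ ((δ ⟶ ψ) List.∷ qs) , R.rule (r , vars-incl) concl-eq premises-derived R.∷ (dδ ++ᵈ d⟶)
        where
        r        = proj₁ (mp δ ψ)
        concl-eq = proj₁ (proj₂ (mp δ ψ))
        prem-eq  = proj₂ (proj₂ (mp δ ψ))
        vars-incl : VarsIncl (prem r) (concl r)
        vars-incl {γ} p with Equivalence.to (prem-eq γ) p
        ... | inj₁ refl = subst (γ ⊆ᵛ_) (sym concl-eq) δ⊆ψ
        ... | inj₂ refl = subst (γ ⊆ᵛ_) (sym concl-eq) (binApp-⊆ᵛ imp ar δ⊆ψ ⊆ᵛ-refl)
        premises-derived : ∀ {γ} → prem r γ → γ ∈ (δ List.∷ ps) ++ ((δ ⟶ ψ) List.∷ qs)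
        premises-derived {γ} p with Equivalence.to (prem-eq γ) p
        ... | inj₁ refl = ∈-++⁺ˡ {xs = δ List.∷ ps} (ListAny.here refl)
        ... | inj₂ refl = ∈-++⁺ʳ (δ List.∷ ps) (ListAny.here refl)

      finite-left⇒restricted : HasMP H imp ar → DeductionThm H imp ar →
        ∀ Δ {ψ} → (∀ {δ} → δ ∈ Δ → δ ⊆ᵛ ψ) → (_∈ Δ) D.⊢ ψ → (_∈ Δ) ⊢ʳᵉ[ H ] ψ
      finite-left⇒restricted mp dt List.[] Δ⊆ψ d = closed⇒restricted (λ ()) d
      finite-left⇒restricted mp dt (δ List.∷ Δ) {ψ} Δ⊆ψ d =
        restricted-mp mp (Δ⊆ψ (ListAny.here refl))
          (List.[] , R.hyp (ListAny.here refl) R.∷ R.[])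
          (⊢-mono ListAny.there
            (finite-left⇒restricted mp dt Δ (λ p x → ⊆ᵛ-binAppʳ imp ar δ ψ x ∘ Δ⊆ψ (ListAny.there p) x) d⟶))
        where
        d⟶ : (_∈ Δ) D.⊢ (δ ⟶ ψ)
        d⟶ = dt (_∈ Δ) δ ψ (⊢-mono (λ { (ListAny.here e) → inj₂ e ; (ListAny.there p) → inj₁ p }) d)

      left⇒restricted : Finitary H → HasMP H imp ar → DeductionThm H imp ar →
        ∀ {Γ φ} → Γ ⊢ˡ[ H ] φ → Γ ⊢ʳᵉ[ H ] φ
      left⇒restricted fin mp dt {φ = φ} (Γ' , Γ'⊆Γ , Γ'⊆φ , d) with fin Γ' φ d
      ... | Δ , Δ⊆Γ' , dΔ = ⊢-mono (Γ'⊆Γ ∘ Δ⊆Γ')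
                              (finite-left⇒restricted mp dt Δ (Γ'⊆φ ∘ Δ⊆Γ') dΔ)

theorem4p3 : (L : Signature) → let open Lang L in
    (H : Hilbert) → Schematic H → Finitary H →
    (imp : Signature.Op L) (ar : Signature.arity L imp ≡ 2) →
    HasMP H imp ar → DeductionThm H imp ar →
    ∀ (Γ : FmSet) (φ : Fm) →
      (Γ ⊢ʳᵉ[ H ] φ → Γ ⊢ˡ[ H ] φ) × (Γ ⊢ˡ[ H ] φ → Γ ⊢ʳᵉ[ H ] φ)
theorem4p3 L H sch fin imp ar mp dt Γ φ =
  restricted⇒left L H , left⇒restricted L H sch imp ar fin mp dt
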